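{- For every integer $n \ge 2$, every induced subgraph of the $n$-dimensional hypercube $Q_n$ that has a unique perfect matching has at most $2^{n-1}$ vertices.
   Context: The $n$-dimensional hypercube $Q_n$ has vertex set $\{0,1\}^n$, two vertices being adjacent iff they differ in exactly one coordinate. -}

module Defs where

open import Data.Nat using (ℕ; zero; suc; _+_)
open import Data.Bool using (Bool; true; false; if_then_else_)
open import Data.Vec using (Vec; []; _∷_)
open import Data.List using (List; []; _∷_; map; _++_; filter; length)
open import Data.Product using (Σ; _×_; _,_)
open import Relation.Binary.PropositionalEquality using (_≡_)
open import Relation.Nullary using (¬_)
open import Data.Bool.Properties using (_≟_)

Vertex : ℕ → Set
Vertex n = Vec Bool n

hamming : ∀ {n} → Vertex n → Vertex n → ℕ
hamming [] [] = 0
hamming (a ∷ u) (b ∷ v) = (if a Data.Bool.xor b then 1 else 0) + hamming u v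
  where import Data.Bool

Adj : ∀ {n} → Vertex n → Vertex n → Set
Adj u v = hamming u v ≡ 1

allVertices : (n : ℕ) → List (Vertex n)
allVertices zero = [] ∷ []
allVertices (suc n) = map (false ∷_) (allVertices n) ++ map (true ∷_) (allVertices n)

-- A vertex subset (the vertex set of an induced subgraph), as a Boolean indicator.
VertexSet : ℕ → Set
VertexSet n = Vertex n → Bool

card : ∀ {n} → VertexSet n → ℕ
card {n} S = length (filter (λ v → S v ≟ true) (allVertices n))

EdgeSet : ℕ → Set
EdgeSet n = Vertex n → Vertex n → Bool

record IsPerfectMatching {n : ℕ} (S : VertexSet n) (M : EdgeSet n) : Set where
  field
    symmetric : ∀ u v → M u v ≡ true → M v u ≡ true
    edge-adj  : ∀ u v → M u v ≡ true → Adj u v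
    edge-in   : ∀ u v → M u v ≡ true → (S u ≡ true) × (S v ≡ true)
    covers    : ∀ u → S u ≡ true → Σ (Vertex n) (λ v → M u v ≡ true)
    unique    : ∀ u v w → M u v ≡ true → M u w ≡ true → v ≡ w

HasUniquePerfectMatching : ∀ {n} → VertexSet n → Set
HasUniquePerfectMatching {n} S =
  Σ (EdgeSet n) (λ M → IsPerfectMatching S M ×
    (∀ M' → IsPerfectMatching S M' → ∀ u v → M' u v ≡ M u v))

-- Let n = j + 1 and work modulo n. The signed adjacency matrix H of Q_j satisfies
-- H² = j·I ≡ -I, so the signed adjacency matrix [[H, I], [I, -H]] of Q_n factors
-- modulo n through 2^j coordinates. If S carries a unique perfect matching, the rows
-- of that matrix indexed by S are independent modulo n: for a combination with some
-- coefficient not divisible by n, the column at the partner of such a support vertex x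
-- forces another support vertex adjacent to that partner; iterating gives an
-- alternating cycle, hence a second perfect matching. So a ↦ a·U (mod n) is injective
-- on (ℤ/n)^S, and n^|S| ≤ n^(2^j).

module Submission where

open import Defs
open import Data.Nat using (ℕ; _≤_; _^_; _∸_)

open import Data.Bool using (Bool; true; false; not; _∧_; _xor_; if_then_else_)
import Data.Bool.Properties as BoolP
open import Data.Empty using (⊥; ⊥-elim)
open import Data.Fin using (Fin; toℕ; fromℕ<)
import Data.Fin.Properties as FP
open import Data.Integer using (ℤ; +_; 0ℤ; 1ℤ; -1ℤ; -_; _-_; _+_; _*_; _⊖_; ∣_∣)
open import Data.Integer.DivMod using (_%ℕ_; _/ℕ_; n%ℕd<d; a≡a%ℕn+[a/ℕn]*n)
open import Data.Integer.Divisibility.Signed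
import Data.Integer.Properties as ℤP
open import Data.Integer.Tactic.RingSolver using (solve-∀)
open import Data.List using (List; []; _∷_; map; _++_; length; filter)
open import Data.List.Membership.Propositional using (_∈_; _∉_)
open import Data.List.Membership.Propositional.Properties using (∈-map⁻; ∈-filter⁻)
open import Data.List.Relation.Unary.All as All using (All; []; _∷_)
open import Data.List.Relation.Unary.All.Properties using (¬All⇒Any¬; All¬⇒¬Any)
import Data.List.Relation.Unary.Any as Any
open import Data.List.Relation.Unary.Any using (here; there)
open import Data.List.Relation.Unary.AllPairs using ([]; _∷_)
open import Data.List.Relation.Unary.Unique.Propositional using (Unique)
import Data.List.Relation.Unary.Unique.Propositional.Properties as UniqueP
open import Data.Nat as ℕ using (zero; suc; _<_; s≤s; z≤n)
open import Data.Nat.Divisibility using (>⇒∤) renaming (_∣_ to _ℕ∣_)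
open import Data.Nat.GeneralisedArithmetic using (fold; fold-+)
import Data.Nat.Properties as ℕP
open import Data.Product using (∃; ∃₂; _×_; _,_; proj₁; proj₂)
open import Data.Sum as Sum using (_⊎_; inj₁; inj₂)
open import Data.Vec using (Vec; []; _∷_; tabulate; lookup)
open import Data.Vec.Properties using (≡-dec; ∷-injectiveʳ; lookup∘tabulate)
open import Data.Vec.Recursive using (lift↔; Fin[m^n]↔Fin[m]^n)
open import Data.Vec.Recursive.Properties using (↔Vec)
open import Function using (_↔_; _↣_; _∘_; Inverse; Injection; Injective)
open import Function.Properties.Inverse using (↔-trans; ↔-sym; ↔⇒↣)
open import Relation.Binary.Definitions using (DecidableEquality; tri<; tri≈; tri>)
open import Relation.Binary.PropositionalEquality
open import Relation.Nullary using (¬_; Dec; does; yes; no)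
open import Relation.Nullary.Decidable using (_⊎-dec_)
import Relation.Unary as U

private
  variable
    A B : Set

∑ : List A → (A → ℤ) → ℤ
∑ [] f = 0ℤ
∑ (x ∷ xs) f = f x + ∑ xs f

infix 5 ∑
syntax ∑ xs (λ x → e) = ∑[ x ∈ xs ] e

∑-++ : ∀ (xs ys : List A) f → ∑ (xs ++ ys) f ≡ ∑ xs f + ∑ ys f
∑-++ [] ys f = sym (ℤP.+-identityˡ _)
∑-++ (x ∷ xs) ys f rewrite ∑-++ xs ys f = sym (ℤP.+-assoc (f x) _ _)

∑-map : ∀ (g : B → A) (xs : List B) f → ∑ (map g xs) f ≡ ∑[ x ∈ xs ] f (g x)
∑-map g [] f = refl
∑-map g (x ∷ xs) f = cong (_+_ (f (g x))) (∑-map g xs f)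

∑-cong : ∀ (xs : List A) {f g : A → ℤ} → (∀ x → f x ≡ g x) → ∑ xs f ≡ ∑ xs g
∑-cong [] f≗g = refl
∑-cong (x ∷ xs) f≗g = cong₂ _+_ (f≗g x) (∑-cong xs f≗g)

∑-zero : ∀ (xs : List A) {f : A → ℤ} → (∀ x → f x ≡ 0ℤ) → ∑ xs f ≡ 0ℤ
∑-zero [] f≗0 = refl
∑-zero (x ∷ xs) f≗0 rewrite f≗0 x = trans (ℤP.+-identityˡ _) (∑-zero xs f≗0)

∑-neg : ∀ (xs : List A) f → ∑[ x ∈ xs ] - f x ≡ - ∑ xs f
∑-neg [] f = refl
∑-neg (x ∷ xs) f rewrite ∑-neg xs f = sym (ℤP.neg-distrib-+ (f x) _)

∑-+ : ∀ (xs : List A) f g → ∑[ x ∈ xs ] (f x + g x) ≡ ∑ xs f + ∑ xs g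
∑-+ [] f g = refl
∑-+ (x ∷ xs) f g rewrite ∑-+ xs f g = middle-four (f x) (g x) (∑ xs f) (∑ xs g)
  where
  middle-four : ∀ a b c d → a + b + (c + d) ≡ a + c + (b + d)
  middle-four = solve-∀

∑-*ˡ : ∀ (xs : List A) c f → ∑[ x ∈ xs ] (c * f x) ≡ c * ∑ xs f
∑-*ˡ [] c f = sym (ℤP.*-zeroʳ c)
∑-*ˡ (x ∷ xs) c f rewrite ∑-*ˡ xs c f = sym (ℤP.*-distribˡ-+ c (f x) _)

∑-*ʳ : ∀ (xs : List A) c f → ∑[ x ∈ xs ] (f x * c) ≡ ∑ xs f * c
∑-*ʳ xs c f = trans (∑-cong xs (λ x → ℤP.*-comm (f x) c)) (trans (∑-*ˡ xs c f) (ℤP.*-comm c _))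

∑-comm : ∀ (xs : List A) (ys : List B) (f : A → B → ℤ) →
  ∑[ x ∈ xs ] ∑[ y ∈ ys ] f x y ≡ ∑[ y ∈ ys ] ∑[ x ∈ xs ] f x y
∑-comm [] ys f = sym (∑-zero ys (λ _ → refl))
∑-comm (x ∷ xs) ys f =
  trans (cong (_+_ (∑ ys (f x))) (∑-comm xs ys f)) (sym (∑-+ ys (f x) _))

∣-∑ : ∀ {k} (xs : List A) f → All (λ x → k ∣ f x) xs → k ∣ ∑ xs f
∣-∑ [] f [] = divides 0ℤ refl
∣-∑ (x ∷ xs) f (k∣fx ∷ k∣fxs) = ∣m∣n⇒∣m+n k∣fx (∣-∑ xs f k∣fxs)

≡0⇒∣ : ∀ {k a} → a ≡ 0ℤ → k ∣ a
≡0⇒∣ {k} refl = divides 0ℤ (sym (ℤP.*-zeroˡ k))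

∣-self-difference : ∀ {k a b} → b ≡ a → k ∣ a - b
∣-self-difference b≡a = ≡0⇒∣ (ℤP.i≡j⇒i-j≡0 (sym b≡a))

∣-*-unit : ∀ {k} c {u} → u ≡ 1ℤ ⊎ u ≡ -1ℤ → k ∣ c * u → k ∣ c
∣-*-unit {k} c (inj₁ refl) k∣c*u = subst (k ∣_) (ℤP.*-identityʳ c) k∣c*u
∣-*-unit {k} c (inj₂ refl) k∣c*u = subst (k ∣_) (lemma c) (∣m⇒∣-m k∣c*u)
  where
  lemma : ∀ c → - (c * -1ℤ) ≡ c
  lemma = solve-∀

_≟_ : ∀ {j} → DecidableEquality (Vertex j)
_≟_ = ≡-dec BoolP._≟_

∑Q : ∀ j → (Vertex j → ℤ) → ℤ
∑Q j f = ∑ (allVertices j) f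

∑Q-suc : ∀ j f → ∑Q (suc j) f ≡ ∑Q j (λ w → f (false ∷ w)) + ∑Q j (λ w → f (true ∷ w))
∑Q-suc j f = begin
  ∑ (map (false ∷_) (allVertices j) ++ map (true ∷_) (allVertices j)) f
    ≡⟨ ∑-++ (map (false ∷_) (allVertices j)) _ f ⟩
  ∑ (map (false ∷_) (allVertices j)) f + ∑ (map (true ∷_) (allVertices j)) f
    ≡⟨ cong₂ _+_ (∑-map (false ∷_) (allVertices j) f) (∑-map (true ∷_) (allVertices j) f) ⟩
  ∑Q j (λ w → f (false ∷ w)) + ∑Q j (λ w → f (true ∷ w)) ∎
  where open ≡-Reasoning

allVertices-unique : ∀ j → Unique (allVertices j)
allVertices-unique zero = [] ∷ []
allVertices-unique (suc j) = UniqueP.++⁺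
  (UniqueP.map⁺ ∷-injectiveʳ (allVertices-unique j))
  (UniqueP.map⁺ ∷-injectiveʳ (allVertices-unique j))
  disjoint
  where
  disjoint : ∀ {v} → ¬ (v ∈ map (false ∷_) (allVertices j) × v ∈ map (true ∷_) (allVertices j))
  disjoint (∈false , ∈true) with ∈-map⁻ (false ∷_) ∈false | ∈-map⁻ (true ∷_) ∈true
  ... | _ , _ , refl | _ , _ , ()

δ : ∀ {j} → Vertex j → Vertex j → ℤ
δ u v = if does (u ≟ v) then 1ℤ else 0ℤ

δ-refl : ∀ {j} (u : Vertex j) → δ u u ≡ 1ℤ
δ-refl u rewrite ≡-≟-identity _≟_ {x = u} refl = refl

δ-≢ : ∀ {j} (u v : Vertex j) → u ≢ v → δ u v ≡ 0ℤ
δ-≢ u v u≢v with u ≟ v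
... | yes u≡v = ⊥-elim (u≢v u≡v)
... | no _ = refl

δ-sym : ∀ {j} (u v : Vertex j) → δ u v ≡ δ v u
δ-sym [] [] = refl
δ-sym (false ∷ u) (false ∷ v) = δ-sym u v
δ-sym (true ∷ u) (true ∷ v) = δ-sym u v
δ-sym (false ∷ u) (true ∷ v) = refl
δ-sym (true ∷ u) (false ∷ v) = refl

∑Q-δˡ : ∀ j (u : Vertex j) g → ∑Q j (λ w → δ u w * g w) ≡ g u
∑Q-δˡ zero [] g = trans (ℤP.+-identityʳ _) (ℤP.*-identityˡ _)
∑Q-δˡ (suc j) (false ∷ u) g = begin
  ∑Q (suc j) (λ w → δ (false ∷ u) w * g w)
    ≡⟨ ∑Q-suc j _ ⟩
  ∑Q j (λ w → δ u w * g (false ∷ w)) + ∑Q j (λ w → 0ℤ * g (true ∷ w))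
    ≡⟨ cong₂ _+_ (∑Q-δˡ j u (λ w → g (false ∷ w))) (∑-zero (allVertices j) (λ _ → refl)) ⟩
  g (false ∷ u) + 0ℤ
    ≡⟨ ℤP.+-identityʳ _ ⟩
  g (false ∷ u) ∎
  where open ≡-Reasoning
∑Q-δˡ (suc j) (true ∷ u) g = begin
  ∑Q (suc j) (λ w → δ (true ∷ u) w * g w)
    ≡⟨ ∑Q-suc j _ ⟩
  ∑Q j (λ w → 0ℤ * g (false ∷ w)) + ∑Q j (λ w → δ u w * g (true ∷ w))
    ≡⟨ cong₂ _+_ (∑-zero (allVertices j) (λ _ → refl)) (∑Q-δˡ j u (λ w → g (true ∷ w))) ⟩
  0ℤ + g (true ∷ u)
    ≡⟨ ℤP.+-identityˡ _ ⟩
  g (true ∷ u) ∎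
  where open ≡-Reasoning

∑Q-δʳ : ∀ j (v : Vertex j) g → ∑Q j (λ w → g w * δ w v) ≡ g v
∑Q-δʳ j v g = trans
  (∑-cong (allVertices j) (λ w → trans (ℤP.*-comm (g w) _) (cong (_* g w) (δ-sym w v))))
  (∑Q-δˡ j v g)

∑Q-other-term : ∀ {j k} (f : Vertex j → ℤ) x → k ∣ ∑Q j f → ¬ k ∣ f x →
  ∃ λ z → z ≢ x × ¬ k ∣ f z
∑Q-other-term {j} {k} f x k∣∑f k∤fx = by-cases (All.all? excused? (allVertices j))
  where
  Excused : Vertex j → Set
  Excused z = z ≡ x ⊎ k ∣ f z
  excused? : ∀ z → Dec (Excused z)
  excused? z = (z ≟ x) ⊎-dec (k ∣? f z)
  rest-divisible : ∀ {z} → Excused z → k ∣ (1ℤ - δ x z) * f z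
  rest-divisible (inj₁ refl) = ≡0⇒∣ (cong (λ d → (1ℤ - d) * f x) (δ-refl x))
  rest-divisible {z} (inj₂ k∣fz) = ∣n⇒∣m*n (1ℤ - δ x z) k∣fz
  split : ∑Q j f ≡ f x + ∑Q j (λ z → (1ℤ - δ x z) * f z)
  split = begin
    ∑Q j f
      ≡⟨ ∑-cong (allVertices j) (λ z → lemma (δ x z) (f z)) ⟩
    ∑Q j (λ z → δ x z * f z + (1ℤ - δ x z) * f z)
      ≡⟨ ∑-+ (allVertices j) _ _ ⟩
    ∑Q j (λ z → δ x z * f z) + ∑Q j (λ z → (1ℤ - δ x z) * f z)
      ≡⟨ cong (_+ ∑Q j (λ z → (1ℤ - δ x z) * f z)) (∑Q-δˡ j x f) ⟩
    f x + ∑Q j (λ z → (1ℤ - δ x z) * f z) ∎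
    where
    open ≡-Reasoning
    lemma : ∀ d a → a ≡ d * a + (1ℤ - d) * a
    lemma = solve-∀
  by-cases : Dec (All Excused (allVertices j)) → ∃ λ z → z ≢ x × ¬ k ∣ f z
  by-cases (no ¬all) = let (z , ¬excused) = Any.satisfied (¬All⇒Any¬ excused? _ ¬all) in
    z , (λ z≡x → ¬excused (inj₁ z≡x)) , (λ k∣fz → ¬excused (inj₂ k∣fz))
  by-cases (yes all) = ⊥-elim (k∤fx (∣m+n∣n⇒∣m (subst (k ∣_) split k∣∑f)
    (∣-∑ _ _ (All.map rest-divisible all))))

infixl 7 _·_

_·_ : ∀ {j} {B : Set} → (Vertex j → ℤ) → (Vertex j → B → ℤ) → B → ℤ
_·_ {j} c R y = ∑Q j (λ x → c x * R x y)

·-assoc : ∀ {a b} (c : Vertex a → ℤ) (R : Vertex a → Vertex b → ℤ) (T : Vertex b → B → ℤ) y →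
  ((c · R) · T) y ≡ (c · (λ x → R x · T)) y
·-assoc {a = a} {b} c R T y = begin
  ∑Q b (λ z → (c · R) z * T z y)
    ≡⟨ ∑-cong (allVertices b) (λ z → sym (∑-*ʳ (allVertices a) (T z y) (λ x → c x * R x z))) ⟩
  ∑Q b (λ z → ∑Q a (λ x → c x * R x z * T z y))
    ≡⟨ ∑-comm (allVertices a) (allVertices b) (λ x z → c x * R x z * T z y) ⟨
  ∑Q a (λ x → ∑Q b (λ z → c x * R x z * T z y))
    ≡⟨ ∑-cong (allVertices a) (λ x → trans
         (∑-cong (allVertices b) (λ z → ℤP.*-assoc (c x) (R x z) (T z y)))
         (∑-*ˡ (allVertices b) (c x) (λ z → R x z * T z y))) ⟩
  ∑Q a (λ x → c x * (R x · T) y) ∎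
  where open ≡-Reasoning

·-split : ∀ {a} (c : Vertex a → ℤ) (R T : Vertex a → B → ℤ) y →
  (c · R) y ≡ (c · (λ x y → R x y - T x y)) y + (c · T) y
·-split {a = a} c R T y = trans
  (∑-cong (allVertices a) (λ x → lemma (c x) (R x y) (T x y)))
  (∑-+ (allVertices a) _ _)
  where
  lemma : ∀ d r t → d * r ≡ d * (r - t) + d * t
  lemma = solve-∀

·-sub : ∀ {a} (c c' : Vertex a → ℤ) (R : Vertex a → B → ℤ) y →
  (c · R) y - (c' · R) y ≡ ((λ x → c x - c' x) · R) y
·-sub {a = a} c c' R y = begin
  (c · R) y - (c' · R) y
    ≡⟨ cong (_+_ ((c · R) y)) (∑-neg (allVertices a) (λ x → c' x * R x y)) ⟨
  (c · R) y + ∑Q a (λ x → - (c' x * R x y))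
    ≡⟨ ∑-+ (allVertices a) _ _ ⟨
  ∑Q a (λ x → c x * R x y + - (c' x * R x y))
    ≡⟨ ∑-cong (allVertices a) (λ x → lemma (c x) (c' x) (R x y)) ⟩
  ((λ x → c x - c' x) · R) y ∎
  where
  open ≡-Reasoning
  lemma : ∀ p q r → p * r + - (q * r) ≡ (p - q) * r
  lemma = solve-∀

∣-·ˡ : ∀ {a k} (c : Vertex a → ℤ) (R : Vertex a → B → ℤ) y →
  (∀ x → k ∣ c x) → k ∣ (c · R) y
∣-·ˡ {a = a} c R y k∣c = ∣-∑ (allVertices a) _ (All.universal (λ x → ∣m⇒∣m*n (R x y) (k∣c x)) _)

∣-·ʳ : ∀ {a k} (c : Vertex a → ℤ) (R : Vertex a → B → ℤ) y →
  (∀ x → k ∣ R x y) → k ∣ (c · R) y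
∣-·ʳ {a = a} c R y k∣R = ∣-∑ (allVertices a) _ (All.universal (λ x → ∣n⇒∣m*n (c x) (k∣R x)) _)

H : ∀ {j} → Vertex j → Vertex j → ℤ
H [] [] = 0ℤ
H (false ∷ u) (false ∷ v) = H u v
H (true ∷ u) (true ∷ v) = - H u v
H (false ∷ u) (true ∷ v) = δ u v
H (true ∷ u) (false ∷ v) = δ u v

H²≡j·δ : ∀ j (x y : Vertex j) → (H x · H) y ≡ + j * δ x y
H²≡j·δ zero [] [] = refl
H²≡j·δ (suc j) (false ∷ u) (false ∷ v) = begin
  (H (false ∷ u) · H) (false ∷ v)
    ≡⟨ ∑Q-suc j _ ⟩
  (H u · H) v + ∑Q j (λ w → δ u w * δ w v)
    ≡⟨ cong₂ _+_ (H²≡j·δ j u v) (∑Q-δˡ j u (λ w → δ w v)) ⟩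
  + j * δ u v + δ u v
    ≡⟨ lemma (+ j) (δ u v) ⟩
  + suc j * δ u v ∎
  where
  open ≡-Reasoning
  lemma : ∀ t d → t * d + d ≡ (1ℤ + t) * d
  lemma = solve-∀
H²≡j·δ (suc j) (true ∷ u) (true ∷ v) = begin
  (H (true ∷ u) · H) (true ∷ v)
    ≡⟨ ∑Q-suc j _ ⟩
  ∑Q j (λ w → δ u w * δ w v) + ∑Q j (λ w → - H u w * - H w v)
    ≡⟨ cong₂ _+_ (∑Q-δˡ j u (λ w → δ w v))
                 (∑-cong (allVertices j) (λ w → neg*neg (H u w) (H w v))) ⟩
  δ u v + (H u · H) v
    ≡⟨ cong (_+_ (δ u v)) (H²≡j·δ j u v) ⟩
  δ u v + + j * δ u v
    ≡⟨ lemma (+ j) (δ u v) ⟩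
  + suc j * δ u v ∎
  where
  open ≡-Reasoning
  neg*neg : ∀ a b → - a * - b ≡ a * b
  neg*neg = solve-∀
  lemma : ∀ t d → d + t * d ≡ (1ℤ + t) * d
  lemma = solve-∀
H²≡j·δ (suc j) (false ∷ u) (true ∷ v) = begin
  (H (false ∷ u) · H) (true ∷ v)
    ≡⟨ ∑Q-suc j _ ⟩
  ∑Q j (λ w → H u w * δ w v) + ∑Q j (λ w → δ u w * - H w v)
    ≡⟨ cong₂ _+_ (∑Q-δʳ j v (H u)) (∑Q-δˡ j u (λ w → - H w v)) ⟩
  H u v - H u v
    ≡⟨ ℤP.+-inverseʳ (H u v) ⟩
  0ℤ
    ≡⟨ ℤP.*-zeroʳ (+ suc j) ⟨
  + suc j * 0ℤ ∎
  where open ≡-Reasoning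
H²≡j·δ (suc j) (true ∷ u) (false ∷ v) = begin
  (H (true ∷ u) · H) (false ∷ v)
    ≡⟨ ∑Q-suc j _ ⟩
  ∑Q j (λ w → δ u w * H w v) + ∑Q j (λ w → - H u w * δ w v)
    ≡⟨ cong₂ _+_ (∑Q-δˡ j u (λ w → H w v)) (∑Q-δʳ j v (λ w → - H u w)) ⟩
  H u v - H u v
    ≡⟨ ℤP.+-inverseʳ (H u v) ⟩
  0ℤ
    ≡⟨ ℤP.*-zeroʳ (+ suc j) ⟨
  + suc j * 0ℤ ∎
  where open ≡-Reasoning

-- U = [I; -H_j] and V = [H_j, I], so U·V = [[H_j, I], [-H_j², -H_j]], and -H_j² = -j·I ≡ I
-- modulo j + 1.
U : ∀ {j} → Vertex (suc j) → Vertex j → ℤ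
U (false ∷ u) = δ u
U (true ∷ u) = λ z → - H u z

V : ∀ {j} → Vertex j → Vertex (suc j) → ℤ
V z (false ∷ v) = H z v
V z (true ∷ v) = δ z v

H≡U·V-mod : ∀ j (x y : Vertex (suc j)) → + suc j ∣ H x y - (U x · V) y
H≡U·V-mod j (false ∷ u) (false ∷ v) = ∣-self-difference (∑Q-δˡ j u (λ z → H z v))
H≡U·V-mod j (false ∷ u) (true ∷ v) = ∣-self-difference (∑Q-δˡ j u (λ z → δ z v))
H≡U·V-mod j (true ∷ u) (true ∷ v) = ∣-self-difference (∑Q-δʳ j v (λ z → - H u z))
H≡U·V-mod j (true ∷ u) (false ∷ v) = divides (δ u v) (begin
  δ u v - ∑Q j (λ z → - H u z * H z v)
    ≡⟨ cong (_-_ (δ u v)) (∑-cong (allVertices j) (λ z → sym (ℤP.neg-distribˡ-* (H u z) (H z v)))) ⟩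
  δ u v - ∑Q j (λ z → - (H u z * H z v))
    ≡⟨ cong (_-_ (δ u v)) (∑-neg (allVertices j) (λ z → H u z * H z v)) ⟩
  δ u v - - (H u · H) v
    ≡⟨ cong (λ t → δ u v - - t) (H²≡j·δ j u v) ⟩
  δ u v - - (+ j * δ u v)
    ≡⟨ lemma (δ u v) (+ j) ⟩
  δ u v * + suc j ∎)
  where
  open ≡-Reasoning
  lemma : ∀ d t → d - - (t * d) ≡ d * (1ℤ + t)
  lemma = solve-∀

·U-divisible⇒·H-divisible : ∀ j (c : Vertex (suc j) → ℤ) →
  (∀ z → + suc j ∣ (c · U) z) → ∀ y → + suc j ∣ (c · H) y
·U-divisible⇒·H-divisible j c k∣c·U y = subst (+ suc j ∣_) (sym (·-split c H (λ x → U x · V) y))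
  (∣m∣n⇒∣m+n (∣-·ʳ c (λ x y → H x y - (U x · V) y) y (λ x → H≡U·V-mod j x y))
             (subst (+ suc j ∣_) (·-assoc c U V y) (∣-·ˡ (c · U) V y k∣c·U)))

hamming-refl : ∀ {j} (u : Vertex j) → hamming u u ≡ 0
hamming-refl [] = refl
hamming-refl (false ∷ u) = hamming-refl u
hamming-refl (true ∷ u) = hamming-refl u

hamming-sym : ∀ {j} (u v : Vertex j) → hamming u v ≡ hamming v u
hamming-sym [] [] = refl
hamming-sym (false ∷ u) (false ∷ v) = hamming-sym u v
hamming-sym (true ∷ u) (true ∷ v) = hamming-sym u v
hamming-sym (false ∷ u) (true ∷ v) = cong suc (hamming-sym u v)
hamming-sym (true ∷ u) (false ∷ v) = cong suc (hamming-sym u v)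

hamming≡0⇒≡ : ∀ {j} (u v : Vertex j) → hamming u v ≡ 0 → u ≡ v
hamming≡0⇒≡ [] [] _ = refl
hamming≡0⇒≡ (false ∷ u) (false ∷ v) eq = cong (false ∷_) (hamming≡0⇒≡ u v eq)
hamming≡0⇒≡ (true ∷ u) (true ∷ v) eq = cong (true ∷_) (hamming≡0⇒≡ u v eq)

Adj-sym : ∀ {j} {u v : Vertex j} → Adj u v → Adj v u
Adj-sym {u = u} {v} = trans (hamming-sym v u)

parity : ∀ {j} → Vertex j → Bool
parity [] = false
parity (a ∷ u) = a xor parity u

parity-Adj : ∀ {j} (u v : Vertex j) → Adj u v → parity u ≡ not (parity v)
parity-Adj [] [] ()
parity-Adj (false ∷ u) (false ∷ v) adj = parity-Adj u v adj
parity-Adj (true ∷ u) (true ∷ v) adj = cong not (parity-Adj u v adj)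
parity-Adj (false ∷ u) (true ∷ v) adj rewrite hamming≡0⇒≡ u v (ℕP.suc-injective adj) =
  sym (BoolP.not-involutive (parity v))
parity-Adj (true ∷ u) (false ∷ v) adj rewrite hamming≡0⇒≡ u v (ℕP.suc-injective adj) = refl

H-Adj : ∀ {j} (x y : Vertex j) → Adj x y → H x y ≡ 1ℤ ⊎ H x y ≡ -1ℤ
H-Adj [] [] ()
H-Adj (false ∷ u) (false ∷ v) adj = H-Adj u v adj
H-Adj (true ∷ u) (true ∷ v) adj = Sum.swap (Sum.map (cong (-_)) (cong (-_)) (H-Adj u v adj))
H-Adj (false ∷ u) (true ∷ v) adj rewrite hamming≡0⇒≡ u v (ℕP.suc-injective adj) = inj₁ (δ-refl v)
H-Adj (true ∷ u) (false ∷ v) adj rewrite hamming≡0⇒≡ u v (ℕP.suc-injective adj) = inj₁ (δ-refl v)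

H-¬Adj : ∀ {j} (x y : Vertex j) → ¬ Adj x y → H x y ≡ 0ℤ
H-¬Adj [] [] _ = refl
H-¬Adj (false ∷ u) (false ∷ v) ¬adj = H-¬Adj u v ¬adj
H-¬Adj (true ∷ u) (true ∷ v) ¬adj = cong (-_) (H-¬Adj u v ¬adj)
H-¬Adj (false ∷ u) (true ∷ v) ¬adj = δ-≢ u v λ { refl → ¬adj (cong suc (hamming-refl u)) }
H-¬Adj (true ∷ u) (false ∷ v) ¬adj = δ-≢ u v λ { refl → ¬adj (cong suc (hamming-refl u)) }

minimal-witness : ∀ {P : ℕ → Set} → U.Decidable P → ∀ {b} → P b →
  ∃ λ r → P r × (∀ {t} → t < r → ¬ P t)
minimal-witness P? {b} Pb with P? 0
... | yes P0 = 0 , P0 , λ ()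
minimal-witness P? {zero} Pb | no ¬P0 = ⊥-elim (¬P0 Pb)
minimal-witness {P} P? {suc b} Pb | no ¬P0 with minimal-witness {λ t → P (suc t)} (λ t → P? (suc t)) Pb
... | r , Pr , below = suc r , Pr , λ { {zero} _ → ¬P0 ; {suc t} (s≤s t<r) → below t<r }

module _ {A : Set} (σ : A → A) where

  fold-preserves : ∀ {P : A → Set} → (∀ {x} → P x → P (σ x)) →
    ∀ {x} → P x → ∀ t → P (fold x σ t)
  fold-preserves σ-preserves Px zero = Px
  fold-preserves {P} σ-preserves {x} Px (suc t) = σ-preserves (fold-preserves {P} σ-preserves {x} Px t)

  simple-cycle : DecidableEquality A → ∀ {x} c → fold x σ (suc c) ≡ x →
    ∃ λ ℓ → fold x σ (suc ℓ) ≡ x × (∀ {a b} → a < b → b < suc ℓ → fold x σ a ≢ fold x σ b)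
  simple-cycle _≟ᴬ_ {x} c returns
    with minimal-witness {λ t → fold x σ (suc t) ≡ x} (λ t → fold x σ (suc t) ≟ᴬ x) {c} returns
  ... | ℓ , returnsℓ , minimal = ℓ , returnsℓ , distinct
    where
    distinct : ∀ {a b} → a < b → b < suc ℓ → fold x σ a ≢ fold x σ b
    distinct {a} {b} a<b (s≤s b≤ℓ) eq with ℕP.m≤n⇒∃[o]m+o≡n b≤ℓ
    ... | e , b+e≡ℓ = minimal e+a<ℓ (begin
      fold x σ (suc e ℕ.+ a)       ≡⟨ fold-+ x σ (suc e) ⟩
      fold (fold x σ a) σ (suc e)  ≡⟨ cong (λ z → fold z σ (suc e)) eq ⟩
      fold (fold x σ b) σ (suc e)  ≡⟨ fold-+ x σ (suc e) ⟨
      fold x σ (suc e ℕ.+ b)       ≡⟨ cong (λ t → fold x σ (suc t)) (trans (ℕP.+-comm e b) b+e≡ℓ) ⟩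
      fold x σ (suc ℓ)             ≡⟨ returnsℓ ⟩
      x                            ∎)
      where
      open ≡-Reasoning
      e+a<ℓ : e ℕ.+ a < ℓ
      e+a<ℓ = ℕP.<-≤-trans (ℕP.+-monoʳ-< e a<b) (ℕP.≤-reflexive (trans (ℕP.+-comm e b) b+e≡ℓ))

  periodic-point : ∀ {m} → A ↣ Fin m → ∀ x → ∃₂ λ s c → fold (fold x σ s) σ (suc c) ≡ fold x σ s
  periodic-point {m} A↣Fin x with FP.pigeonhole (ℕP.n<1+n m) (Injection.to A↣Fin ∘ fold x σ ∘ toℕ)
  ... | i , i' , i<i' , eq with ℕP.m≤n⇒∃[o]m+o≡n i<i'
  ...   | c , i+1+c≡i' = toℕ i , c , sym (begin
    fold x σ (toℕ i)                   ≡⟨ Injection.injective A↣Fin eq ⟩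
    fold x σ (toℕ i')                  ≡⟨ cong (fold x σ) (trans (sym i+1+c≡i') (ℕP.+-comm (suc (toℕ i)) c)) ⟩
    fold x σ (c ℕ.+ suc (toℕ i))       ≡⟨ cong (fold x σ) (ℕP.+-suc c (toℕ i)) ⟩
    fold x σ (suc c ℕ.+ toℕ i)         ≡⟨ fold-+ x σ (suc c) ⟩
    fold (fold x σ (toℕ i)) σ (suc c)  ∎)
    where open ≡-Reasoning

Vertex↔Fin : ∀ j → Vertex j ↔ Fin (2 ^ j)
Vertex↔Fin j = ↔-trans (↔-sym (↔Vec j))
  (↔-trans (lift↔ j (↔-sym FP.2↔Bool)) (↔-sym (Fin[m^n]↔Fin[m]^n 2 j)))

module PerfectMatching {n} {S : VertexSet n} {M : EdgeSet n} (pm : IsPerfectMatching S M) where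

  open IsPerfectMatching pm

  private
    partner-of : ∀ u (b : Bool) → S u ≡ b → Vertex n
    partner-of u true u∈S = proj₁ (covers u u∈S)
    partner-of u false _ = u

    partner-of-matched : ∀ u b (eq : S u ≡ b) → b ≡ true → M u (partner-of u b eq) ≡ true
    partner-of-matched u true eq _ = proj₂ (covers u eq)

  partner : Vertex n → Vertex n
  partner u = partner-of u (S u) refl

  partner-matched : ∀ u → S u ≡ true → M u (partner u) ≡ true
  partner-matched u = partner-of-matched u (S u) refl

  partner-in : ∀ u → S u ≡ true → S (partner u) ≡ true
  partner-in u u∈S = proj₂ (edge-in u (partner u) (partner-matched u u∈S))

  partner-Adj : ∀ u → S u ≡ true → Adj u (partner u)
  partner-Adj u u∈S = edge-adj u (partner u) (partner-matched u u∈S)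

  partner-involutive : ∀ u → S u ≡ true → partner (partner u) ≡ u
  partner-involutive u u∈S = unique (partner u) (partner (partner u)) u
    (partner-matched (partner u) (partner-in u u∈S))
    (symmetric u (partner u) (partner-matched u u∈S))

  partner-injective : ∀ {u v} → S u ≡ true → S v ≡ true → partner u ≡ partner v → u ≡ v
  partner-injective {u} {v} u∈S v∈S eq = begin
    u                     ≡⟨ partner-involutive u u∈S ⟨
    partner (partner u)   ≡⟨ cong partner eq ⟩
    partner (partner v)   ≡⟨ partner-involutive v v∈S ⟩
    v                     ∎
    where open ≡-Reasoning

  parity-partner : ∀ u → S u ≡ true → parity (partner u) ≡ not (parity u)
  parity-partner u u∈S = parity-Adj (partner u) u (Adj-sym {u = u} (partner-Adj u u∈S))

  support-neighbour : ∀ k (c : Vertex n → ℤ) x → S x ≡ true → ¬ k ∣ c x → k ∣ (c · H) (partner x) →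
    ∃ λ x' → ¬ k ∣ c x' × x' ≢ x × Adj x' (partner x)
  support-neighbour k c x x∈S k∤cx k∣column
    with ∑Q-other-term (λ z → c z * H z (partner x)) x k∣column k∤term
    where
    k∤term : ¬ k ∣ c x * H x (partner x)
    k∤term = k∤cx ∘ ∣-*-unit (c x) (H-Adj x (partner x) (partner-Adj x x∈S))
  ... | z , z≢x , k∤term = z , k∤term ∘ ∣m⇒∣m*n (H z (partner x)) , z≢x , adjacent
    where
    adjacent : Adj z (partner x)
    adjacent with hamming z (partner x) ℕ.≟ 1
    ... | yes adj = adj
    ... | no ¬adj = ⊥-elim (k∤term (≡0⇒∣
      (trans (cong (c z *_) (H-¬Adj z (partner x) ¬adj)) (ℤP.*-zeroʳ (c z)))))

  -- y 0, partner (y 0), y 1, partner (y 1), …, y (suc ℓ) = y 0 is an alternating cycle;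
  -- rerouting matches partner (y i) with y (suc i) instead of y i.
  module Rerouting (y : ℕ → Vertex n) (ℓ : ℕ)
      (y-in : ∀ t → S (y t) ≡ true)
      (closed : y (suc ℓ) ≡ y 0)
      (distinct : ∀ {a b} → a < b → b < suc ℓ → y a ≢ y b)
      (alternating : ∀ t → Adj (y (suc t)) (partner (y t))) where

    r : ℕ
    r = suc ℓ

    y-injective : ∀ {a b} → a < r → b < r → y a ≡ y b → a ≡ b
    y-injective {a} {b} a<r b<r eq with ℕP.<-cmp a b
    ... | tri< a<b _ _ = ⊥-elim (distinct a<b b<r eq)
    ... | tri≈ _ a≡b _ = a≡b
    ... | tri> _ _ b<a = ⊥-elim (distinct b<a a<r (sym eq))

    cycle-pred : ∀ {i} → i < r → ∃ λ i' → i' < r × y i ≡ y (suc i')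
    cycle-pred {zero} _ = ℓ , ℕP.n<1+n ℓ , sym closed
    cycle-pred {suc i} i+1<r = i , ℕP.<-trans (ℕP.n<1+n i) i+1<r , refl

    cycle-succ : ∀ {i} → i < r → ∃ λ i' → i' < r × y (suc i) ≡ y i'
    cycle-succ {i} i<r with ℕP.m≤n⇒m<n∨m≡n i<r
    ... | inj₁ i+1<r = suc i , i+1<r , refl
    ... | inj₂ i+1≡r = 0 , s≤s z≤n , trans (cong y i+1≡r) closed

    y-suc-injective : ∀ {a b} → a < r → b < r → y (suc a) ≡ y (suc b) → a ≡ b
    y-suc-injective {a} {b} a<r b<r eq
      with ℕP.m≤n⇒m<n∨m≡n a<r | ℕP.m≤n⇒m<n∨m≡n b<r
    ... | inj₁ a+1<r | inj₁ b+1<r = ℕP.suc-injective (y-injective a+1<r b+1<r eq)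
    ... | inj₁ a+1<r | inj₂ b+1≡r =
          ⊥-elim (ℕP.1+n≢0 (y-injective a+1<r (s≤s z≤n) (trans eq (trans (cong y b+1≡r) closed))))
    ... | inj₂ a+1≡r | inj₁ b+1<r =
          ⊥-elim (ℕP.1+n≢0 (y-injective b+1<r (s≤s z≤n) (trans (sym eq) (trans (cong y a+1≡r) closed))))
    ... | inj₂ a+1≡r | inj₂ b+1≡r = ℕP.suc-injective (trans a+1≡r (sym b+1≡r))

    y-parity : ∀ t → parity (y t) ≡ parity (y 0)
    y-parity zero = refl
    y-parity (suc t) = begin
      parity (y (suc t))              ≡⟨ parity-Adj (y (suc t)) (partner (y t)) (alternating t) ⟩
      not (parity (partner (y t)))    ≡⟨ cong not (parity-partner (y t) (y-in t)) ⟩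
      not (not (parity (y t)))        ≡⟨ BoolP.not-involutive (parity (y t)) ⟩
      parity (y t)                    ≡⟨ y-parity t ⟩
      parity (y 0)                    ∎
      where open ≡-Reasoning

    partner-y≢y : ∀ i i' → partner (y i) ≢ y i'
    partner-y≢y i i' eq = BoolP.not-¬ refl (begin
      parity (y 0)                    ≡⟨ y-parity i' ⟨
      parity (y i')                   ≡⟨ cong parity eq ⟨
      parity (partner (y i))          ≡⟨ parity-partner (y i) (y-in i) ⟩
      not (parity (y i))              ≡⟨ cong not (y-parity i) ⟩
      not (parity (y 0))              ∎)
      where open ≡-Reasoning

    OnPartners OnCycle : Vertex n → Set
    OnPartners u = ∃ λ i → i < r × u ≡ partner (y i)
    OnCycle u = ∃ λ i → i < r × u ≡ y (suc i)

    private
      reroute-with : ∀ u → Dec (OnPartners u) → Dec (OnCycle u) → Vertex n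
      reroute-with u (yes (i , _)) _ = y (suc i)
      reroute-with u (no _) (yes (i , _)) = partner (y i)
      reroute-with u (no _) (no _) = partner u

    onPartners? : ∀ u → Dec (OnPartners u)
    onPartners? u = ℕP.anyUpTo? (λ i → u ≟ partner (y i)) r

    onCycle? : ∀ u → Dec (OnCycle u)
    onCycle? u = ℕP.anyUpTo? (λ i → u ≟ y (suc i)) r

    reroute : Vertex n → Vertex n
    reroute u = reroute-with u (onPartners? u) (onCycle? u)

    reroute-partner : ∀ {u i} → i < r → u ≡ partner (y i) → reroute u ≡ y (suc i)
    reroute-partner {u} {i} i<r u≡ = go (onPartners? u) (onCycle? u)
      where
      go : ∀ p c → reroute-with u p c ≡ y (suc i)
      go (yes (i' , i'<r , u≡')) _ = cong (λ t → y (suc t))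
        (y-injective i'<r i<r (partner-injective (y-in i') (y-in i) (trans (sym u≡') u≡)))
      go (no ¬p) _ = ⊥-elim (¬p (i , i<r , u≡))

    reroute-cycle : ∀ {u i} → i < r → u ≡ y (suc i) → reroute u ≡ partner (y i)
    reroute-cycle {u} {i} i<r u≡ = go (onPartners? u) (onCycle? u)
      where
      go : ∀ p c → reroute-with u p c ≡ partner (y i)
      go (yes (i' , _ , u≡')) _ = ⊥-elim (partner-y≢y i' (suc i) (trans (sym u≡') u≡))
      go (no _) (yes (i' , i'<r , u≡')) = cong (λ t → partner (y t))
        (y-suc-injective i'<r i<r (trans (sym u≡') u≡))
      go (no _) (no ¬c) = ⊥-elim (¬c (i , i<r , u≡))

    reroute-elsewhere : ∀ {u} → ¬ OnPartners u → ¬ OnCycle u → reroute u ≡ partner u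
    reroute-elsewhere {u} ¬p ¬c = go (onPartners? u) (onCycle? u)
      where
      go : ∀ p c → reroute-with u p c ≡ partner u
      go (yes p) _ = ⊥-elim (¬p p)
      go (no _) (yes c) = ⊥-elim (¬c c)
      go (no _) (no _) = refl

    reroute-spec : ∀ u → S u ≡ true →
      S (reroute u) ≡ true × Adj u (reroute u) × reroute (reroute u) ≡ u
    reroute-spec u u∈S = by-cases (onPartners? u) (onCycle? u)
      where
      via : ∀ {v} → reroute u ≡ v → S v ≡ true → Adj u v → reroute v ≡ u →
        S (reroute u) ≡ true × Adj u (reroute u) × reroute (reroute u) ≡ u
      via refl v∈S u~v back = v∈S , u~v , back

      by-cases : Dec (OnPartners u) → Dec (OnCycle u) →
        S (reroute u) ≡ true × Adj u (reroute u) × reroute (reroute u) ≡ u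
      by-cases (yes (i , i<r , u≡)) _ =
        via (reroute-partner i<r u≡) (y-in (suc i))
          (subst (λ w → Adj w (y (suc i))) (sym u≡) (Adj-sym {u = y (suc i)} (alternating i)))
          (trans (reroute-cycle i<r refl) (sym u≡))
      by-cases (no _) (yes (i , i<r , u≡)) =
        via (reroute-cycle i<r u≡) (partner-in (y i) (y-in i))
          (subst (λ w → Adj w (partner (y i))) (sym u≡) (alternating i))
          (trans (reroute-partner i<r refl) (sym u≡))
      by-cases (no ¬p) (no ¬c) =
        via (reroute-elsewhere ¬p ¬c) (partner-in u u∈S) (partner-Adj u u∈S)
          (trans (reroute-elsewhere ¬p' ¬c') (partner-involutive u u∈S))
        where
        ¬p' : ¬ OnPartners (partner u)
        ¬p' (i , i<r , eq) = let (i' , i'<r , y≡) = cycle-pred i<r in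
          ¬c (i' , i'<r , trans (partner-injective u∈S (y-in i) eq) y≡)
        ¬c' : ¬ OnCycle (partner u)
        ¬c' (i , i<r , eq) = let (i' , i'<r , y≡) = cycle-succ i<r in
          ¬p (i' , i'<r , trans (sym (partner-involutive u u∈S)) (cong partner (trans eq y≡)))

    rerouted : EdgeSet n
    rerouted u v = S u ∧ does (v ≟ reroute u)

    rerouted⇒reroute : ∀ u v → S u ∧ does (v ≟ reroute u) ≡ true → S u ≡ true × v ≡ reroute u
    rerouted⇒reroute u v eq with S u | v ≟ reroute u
    ... | true | yes v≡ = refl , v≡

    reroute⇒rerouted : ∀ u → S u ≡ true → rerouted u (reroute u) ≡ true
    reroute⇒rerouted u u∈S rewrite u∈S | ≡-≟-identity _≟_ {x = reroute u} refl = refl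

    rerouted-perfect : IsPerfectMatching S rerouted
    rerouted-perfect = record
      { symmetric = λ u v e →
          let (u∈S , v≡) = rerouted⇒reroute u v e
              (ru∈S , _ , rru≡u) = reroute-spec u u∈S
          in subst₂ (λ a b → rerouted a b ≡ true) (sym v≡) rru≡u (reroute⇒rerouted (reroute u) ru∈S)
      ; edge-adj = λ u v e →
          let (u∈S , v≡) = rerouted⇒reroute u v e in
          subst (Adj u) (sym v≡) (proj₁ (proj₂ (reroute-spec u u∈S)))
      ; edge-in = λ u v e →
          let (u∈S , v≡) = rerouted⇒reroute u v e in
          u∈S , subst (λ w → S w ≡ true) (sym v≡) (proj₁ (reroute-spec u u∈S))
      ; covers = λ u u∈S → reroute u , reroute⇒rerouted u u∈S
      ; unique = λ u v w e e' →
          trans (proj₂ (rerouted⇒reroute u v e)) (sym (proj₂ (rerouted⇒reroute u w e')))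
      }

    rerouted-partner-y₀ : rerouted (partner (y 0)) (y 1) ≡ true
    rerouted-partner-y₀ = subst (λ v → rerouted (partner (y 0)) v ≡ true)
      (reroute-partner (s≤s z≤n) refl) (reroute⇒rerouted (partner (y 0)) (partner-in (y 0) (y-in 0)))

-- The rows of H indexed by S are linearly independent over ℤ/k.
IndependentRowsMod : ∀ {n} → ℤ → VertexSet n → Set
IndependentRowsMod {n} k S = ∀ (c : Vertex n → ℤ) → (∀ x → ¬ k ∣ c x → S x ≡ true) →
  (∀ y → k ∣ (c · H) y) → ∀ x → k ∣ c x

unique-matching⇒independent-rows : ∀ {n} {S : VertexSet n} → HasUniquePerfectMatching S →
  ∀ k → IndependentRowsMod k S
unique-matching⇒independent-rows {n} {S} (M , pm , M-unique) k c support k∣c·H x with k ∣? c x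
... | yes k∣cx = k∣cx
... | no k∤cx = ⊥-elim no-second-matching
  where
  open IsPerfectMatching pm
  open PerfectMatching pm

  -- Iterating σ from a support vertex eventually traces an alternating cycle.
  σ : Vertex n → Vertex n
  σ x with k ∣? c x
  ... | yes _ = x
  ... | no k∤cx = proj₁ (support-neighbour k c x (support x k∤cx) k∤cx (k∣c·H (partner x)))

  σ-spec : ∀ {x} → ¬ k ∣ c x → ¬ k ∣ c (σ x) × σ x ≢ x × Adj (σ x) (partner x)
  σ-spec {x} k∤cx with k ∣? c x
  ... | yes k∣cx = ⊥-elim (k∤cx k∣cx)
  ... | no k∤cx' = proj₂ (support-neighbour k c x (support x k∤cx') k∤cx' (k∣c·H (partner x)))

  σ-preserves : ∀ {x} → ¬ k ∣ c x → ¬ k ∣ c (σ x)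
  σ-preserves k∤cx = proj₁ (σ-spec k∤cx)

  no-second-matching : ⊥
  no-second-matching with periodic-point σ (↔⇒↣ (Vertex↔Fin n)) x
  ... | s , p , returns with simple-cycle σ _≟_ p returns
  ... | ℓ , closed , distinct = y₁≢y₀ (unique (partner (y 0)) (y 1) (y 0) M-y₀-y₁ M-y₀-y₀)
    where
    y : ℕ → Vertex n
    y = fold (fold x σ s) σ

    y-support : ∀ t → ¬ k ∣ c (y t)
    y-support = fold-preserves σ {P = λ z → ¬ k ∣ c z} σ-preserves
      (fold-preserves σ {P = λ z → ¬ k ∣ c z} σ-preserves k∤cx s)

    y-in : ∀ t → S (y t) ≡ true
    y-in t = support (y t) (y-support t)

    open Rerouting y ℓ y-in closed distinct (λ t → proj₂ (proj₂ (σ-spec (y-support t))))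

    y₁≢y₀ : y 1 ≢ y 0
    y₁≢y₀ = proj₁ (proj₂ (σ-spec (y-support 0)))

    M-y₀-y₁ : M (partner (y 0)) (y 1) ≡ true
    M-y₀-y₁ = trans (sym (M-unique rerouted rerouted-perfect (partner (y 0)) (y 1))) rerouted-partner-y₀

    M-y₀-y₀ : M (partner (y 0)) (y 0) ≡ true
    M-y₀-y₀ = symmetric (y 0) (partner (y 0)) (partner-matched (y 0) (y-in 0))

Vec↔Fin : ∀ m k → Vec (Fin m) k ↔ Fin (m ^ k)
Vec↔Fin m k = ↔-trans (↔-sym (↔Vec k)) (↔-sym (Fin[m^n]↔Fin[m]^n m k))

Vec-injection⇒≤ : ∀ {m k l} → 2 ≤ m → (f : Vec (Fin m) k → Vec (Fin m) l) →
  Injective _≡_ _≡_ f → k ≤ l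
Vec-injection⇒≤ {m} {k} {l} 2≤m f f-injective = ℕP.≮⇒≥ λ l<k →
  ℕP.<⇒≱ (ℕP.^-monoʳ-< m 2≤m l<k) (FP.injective⇒≤ g-injective)
  where
  open Injection
  g : Fin (m ^ k) → Fin (m ^ l)
  g i = to (↔⇒↣ (Vec↔Fin m l)) (f (to (↔⇒↣ (↔-sym (Vec↔Fin m k))) i))
  g-injective : Injective _≡_ _≡_ g
  g-injective eq = injective (↔⇒↣ (↔-sym (Vec↔Fin m k)))
    (f-injective (injective (↔⇒↣ (Vec↔Fin m l)) eq))

residue : ∀ m .{{_ : ℕ.NonZero m}} → ℤ → Fin m
residue m a = fromℕ< (n%ℕd<d a m)

residue-≡⇒∣ : ∀ m .{{_ : ℕ.NonZero m}} a b → residue m a ≡ residue m b → + m ∣ a - b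
residue-≡⇒∣ m a b eq = divides (a /ℕ m - b /ℕ m) (begin
  a - b
    ≡⟨ cong₂ _-_ (a≡a%ℕn+[a/ℕn]*n a m) (a≡a%ℕn+[a/ℕn]*n b m) ⟩
  (+ (a %ℕ m) + a /ℕ m * + m) - (+ (b %ℕ m) + b /ℕ m * + m)
    ≡⟨ cong (λ t → (+ (a %ℕ m) + a /ℕ m * + m) - (+ t + b /ℕ m * + m)) remainders ⟨
  (+ (a %ℕ m) + a /ℕ m * + m) - (+ (a %ℕ m) + b /ℕ m * + m)
    ≡⟨ lemma (+ (a %ℕ m)) (a /ℕ m) (b /ℕ m) (+ m) ⟩
  (a /ℕ m - b /ℕ m) * + m ∎)
  where
  open ≡-Reasoning
  remainders : a %ℕ m ≡ b %ℕ m
  remainders = trans (sym (FP.toℕ-fromℕ< (n%ℕd<d a m)))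
    (trans (cong toℕ eq) (FP.toℕ-fromℕ< (n%ℕd<d b m)))
  lemma : ∀ r p q d → (r + p * d) - (r + q * d) ≡ (p - q) * d
  lemma = solve-∀

Fin-congruent⇒≡ : ∀ {m} (a b : Fin m) → + m ∣ + toℕ a - + toℕ b → a ≡ b
Fin-congruent⇒≡ {m} a b m∣a-b = FP.toℕ-injective (ℤP.+-injective
  (ℤP.i-j≡0⇒i≡j (+ toℕ a) (+ toℕ b) (ℤP.∣i∣≡0⇒i≡0 (small-multiple (∣⇒∣ᵤ m∣a-b)))))
  where
  bound : ∣ + toℕ a - + toℕ b ∣ < m
  bound = begin-strict
    ∣ + toℕ a - + toℕ b ∣  ≡⟨ cong ∣_∣ (ℤP.[+m]-[+n]≡m⊖n (toℕ a) (toℕ b)) ⟩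
    ∣ toℕ a ⊖ toℕ b ∣      ≤⟨ ℤP.∣m⊝n∣≤m⊔n (toℕ a) (toℕ b) ⟩
    toℕ a ℕ.⊔ toℕ b        <⟨ ℕP.⊔-lub (FP.toℕ<n a) (FP.toℕ<n b) ⟩
    m                      ∎
    where open ℕP.≤-Reasoning
  small-multiple : m ℕ∣ ∣ + toℕ a - + toℕ b ∣ → ∣ + toℕ a - + toℕ b ∣ ≡ 0
  small-multiple m∣d with ∣ + toℕ a - + toℕ b ∣ in eq
  ... | zero = refl
  ... | suc _ = ⊥-elim (>⇒∤ (subst (_< m) eq bound) m∣d)

weights : ∀ {j m} (xs : List (Vertex j)) → Vec (Fin m) (length xs) → Vertex j → ℤ
weights [] [] x = 0ℤ
weights (v ∷ xs) (a ∷ as) x = + toℕ a * δ v x + weights xs as x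

weights-∉ : ∀ {j m} (xs : List (Vertex j)) (as : Vec (Fin m) (length xs)) {x} → x ∉ xs →
  weights xs as x ≡ 0ℤ
weights-∉ [] [] _ = refl
weights-∉ (v ∷ xs) (a ∷ as) {x} x∉ = begin
  + toℕ a * δ v x + weights xs as x
    ≡⟨ cong₂ (λ d w → + toℕ a * d + w)
         (δ-≢ v x (λ v≡x → x∉ (here (sym v≡x)))) (weights-∉ xs as (x∉ ∘ there)) ⟩
  + toℕ a * 0ℤ + 0ℤ
    ≡⟨ trans (ℤP.+-identityʳ _) (ℤP.*-zeroʳ (+ toℕ a)) ⟩
  0ℤ ∎
  where open ≡-Reasoning

weights-injective : ∀ {j m} {xs : List (Vertex j)} → Unique xs → (as bs : Vec (Fin m) (length xs)) →
  (∀ x → + m ∣ weights xs as x - weights xs bs x) → as ≡ bs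
weights-injective {xs = []} _ [] [] _ = refl
weights-injective {m = m} {xs = v ∷ xs} (v∉xs ∷ xs-unique) (a ∷ as) (b ∷ bs) m∣diff =
  cong₂ _∷_ a≡b (weights-injective xs-unique as bs m∣tail)
  where
  split : ∀ x → weights (v ∷ xs) (a ∷ as) x - weights (v ∷ xs) (b ∷ bs) x
              ≡ (+ toℕ a - + toℕ b) * δ v x + (weights xs as x - weights xs bs x)
  split x = lemma (+ toℕ a) (+ toℕ b) (δ v x) (weights xs as x) (weights xs bs x)
    where
    lemma : ∀ p q d s t → (p * d + s) - (q * d + t) ≡ (p - q) * d + (s - t)
    lemma = solve-∀
  m∣a-b : + m ∣ + toℕ a - + toℕ b
  m∣a-b = subst (+ m ∣_) (begin
    weights (v ∷ xs) (a ∷ as) v - weights (v ∷ xs) (b ∷ bs) v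
      ≡⟨ split v ⟩
    (+ toℕ a - + toℕ b) * δ v v + (weights xs as v - weights xs bs v)
      ≡⟨ cong₂ (λ d t → (+ toℕ a - + toℕ b) * d + t) (δ-refl v)
           (cong₂ _-_ (weights-∉ xs as v∉) (weights-∉ xs bs v∉)) ⟩
    (+ toℕ a - + toℕ b) * 1ℤ + 0ℤ
      ≡⟨ trans (ℤP.+-identityʳ _) (ℤP.*-identityʳ _) ⟩
    + toℕ a - + toℕ b ∎) (m∣diff v)
    where
    open ≡-Reasoning
    v∉ : v ∉ xs
    v∉ = All¬⇒¬Any v∉xs
  a≡b : a ≡ b
  a≡b = Fin-congruent⇒≡ a b m∣a-b
  m∣tail : ∀ x → + m ∣ weights xs as x - weights xs bs x
  m∣tail x = ∣m+n∣m⇒∣n (subst (+ m ∣_) (split x) (m∣diff x)) (∣m⇒∣m*n (δ v x) m∣a-b)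

residues : ∀ {j} m .{{_ : ℕ.NonZero m}} → (Vertex j → ℤ) → Vec (Fin m) (2 ^ j)
residues {j} m f = tabulate (residue m ∘ f ∘ Inverse.from (Vertex↔Fin j))

residues-≡⇒∣ : ∀ {j} m .{{_ : ℕ.NonZero m}} (f g : Vertex j → ℤ) →
  residues m f ≡ residues m g → ∀ z → + m ∣ f z - g z
residues-≡⇒∣ {j} m f g eq z = residue-≡⇒∣ m (f z) (g z) (begin
  residue m (f z)                ≡⟨ cong (residue m ∘ f) (strictlyInverseʳ z) ⟨
  residue m (f (from (to z)))    ≡⟨ lookup∘tabulate (residue m ∘ f ∘ from) (to z) ⟨
  lookup (residues m f) (to z)   ≡⟨ cong (λ w → lookup w (to z)) eq ⟩
  lookup (residues m g) (to z)   ≡⟨ lookup∘tabulate (residue m ∘ g ∘ from) (to z) ⟩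
  residue m (g (from (to z)))    ≡⟨ cong (residue m ∘ g) (strictlyInverseʳ z) ⟩
  residue m (g z)                ∎)
  where
  open ≡-Reasoning
  open Inverse (Vertex↔Fin j)

independent-rows⇒card≤ : ∀ j (S : VertexSet (suc j)) → 2 ≤ suc j →
  IndependentRowsMod (+ suc j) S → card S ≤ 2 ^ j
independent-rows⇒card≤ j S 2≤n independent = Vec-injection⇒≤ 2≤n encode encode-injective
  where
  n = suc j
  Sˡ : List (Vertex n)
  Sˡ = filter (λ v → S v BoolP.≟ true) (allVertices n)

  encode : Vec (Fin n) (card S) → Vec (Fin n) (2 ^ j)
  encode as = residues n (weights Sˡ as · U)

  encode-injective : Injective _≡_ _≡_ encode
  encode-injective {as} {bs} eq = weights-injective
    (UniqueP.filter⁺ (λ v → S v BoolP.≟ true) (allVertices-unique n)) as bs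
    (independent Δ support (·U-divisible⇒·H-divisible j Δ Δ·U-divisible))
    where
    Δ : Vertex n → ℤ
    Δ x = weights Sˡ as x - weights Sˡ bs x
    Δ·U-divisible : ∀ z → + n ∣ (Δ · U) z
    Δ·U-divisible z = subst (+ n ∣_) (·-sub (weights Sˡ as) (weights Sˡ bs) U z)
      (residues-≡⇒∣ n (weights Sˡ as · U) (weights Sˡ bs · U) eq z)
    support : ∀ x → ¬ + n ∣ Δ x → S x ≡ true
    support x n∤Δx with S x BoolP.≟ true
    ... | yes x∈S = x∈S
    ... | no x∉S =
      ⊥-elim (n∤Δx (≡0⇒∣ (cong₂ _-_ (weights-∉ Sˡ as x∉Sˡ) (weights-∉ Sˡ bs x∉Sˡ))))
      where
      x∉Sˡ : x ∉ Sˡ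
      x∉Sˡ x∈Sˡ = x∉S (proj₂ (∈-filter⁻ (λ v → S v BoolP.≟ true) {xs = allVertices n} x∈Sˡ))

theorem1 : (n : ℕ) → 2 ≤ n → (S : VertexSet n) →
    HasUniquePerfectMatching S → card S ≤ 2 ^ (n ∸ 1)
theorem1 (suc j) 2≤n S unique-pm =
  independent-rows⇒card≤ j S 2≤n (unique-matching⇒independent-rows unique-pm (+ suc j))
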